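{- For any model $\mathcal{M}$, world $w$ and information state $X$: (1) if $\mathcal{M},w,X\vDash \mathtt{good}_L$, then $[\![\mathtt{info}_L]\!]^{\mathcal{M},X}$ is a $\Theta$-subset of $X$; (2) if $Y$ is a maximal $\Theta$-subset of $X$, there is a $K\subseteq I$ such that $Y=[\![\mathtt{info}_K]\!]^{\mathcal{M},X}$ and $\mathcal{M},w,X\vDash \mathtt{max}_K$; (3) if $\mathcal{M},w,X\vDash \mathtt{max}_L$, then $[\![\mathtt{info}_L]\!]^{\mathcal{M},X}$ is a maximal $\Theta$-subset of $X$.
   Context: Models $\mathcal{M}=\langle W,V\rangle$; modal formulas ($\Box$, $\Diamond=\neg\Box\neg$) evaluated at $w$ relative to $X\subseteq W$ with $\mathcal{M},w,X\vDash\Box\varphi$ iff $\mathcal{M},v,X\vDash\varphi$ for all $v\in X$; $[\![\varphi]\!]^{\mathcal{M},X}=\{v\in X\mid \mathcal{M},v,X\vDash\varphi\}$. Let $\Theta=\bigvee_{i\in I}\theta_i$ with $\theta_i= \varphi_i\wedge \Box\psi_i \wedge \bigwedge_{n\in D_i} \Diamond\chi_n$ and $\varphi_i,\psi_i,\chi_n$ nonmodal (no $\Box$). For $K\subseteq I$: $\mathtt{info}_K:= (\bigvee_{k\in K} \varphi_k )\wedge \bigwedge_{k\in K}\psi_k$; $\mathtt{good}_K:= \bigwedge_{k\in K}\bigwedge_{n \in D_k} \Diamond (\mathtt{info}_K \wedge\chi_n)$; $\mathtt{max}_K:= \mathtt{good}_K\wedge \bigwedge_{L\subseteq I}\big(\big(\Box(\mathtt{info}_K\rightarrow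 \mathtt{info}_L)\wedge \Diamond (\neg \mathtt{info}_K\wedge\mathtt{info}_L)\big)\rightarrow \neg\mathtt{good}_L \big)$. $Y\subseteq X$ is a $\Theta$-subset of $X$ if $Y\subseteq [\![\Theta]\!]^{\mathcal{M},Y}$; it is maximal if no $\Theta$-subset $Z$ of $X$ satisfies $Y\subsetneq Z$. -}

module Defs where

open import Level using (0ℓ)
open import Data.Nat using (ℕ)
open import Data.Bool using (Bool; true; false)
open import Data.Fin using (Fin)
open import Data.Fin.Subset using (Subset; inside; outside)
open import Data.Vec using (Vec; []; _∷_; lookup)
open import Data.List using (List; []; _∷_; map; _++_; foldr)
open import Data.List.Relation.Unary.All using (All)
open import Data.Product using (_×_; Σ)
open import Data.Sum using (_⊎_)
open import Data.Empty using (⊥)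
open import Data.Unit using (⊤)
open import Relation.Nullary using (¬_)

data Form : Set where
  atom : ℕ → Form
  ⊥f   : Form
  ¬f_  : Form → Form
  _∧f_ : Form → Form → Form
  _∨f_ : Form → Form → Form
  □_   : Form → Form

infixr 6 _∧f_
infixr 5 _∨f_
infixr 4 _→f_

⊤f : Form
⊤f = ¬f ⊥f

◇_ : Form → Form
◇ φ = ¬f (□ (¬f φ))

_→f_ : Form → Form → Form
φ →f ψ = (¬f φ) ∨f ψ

NonModal : Form → Set
NonModal (atom _) = ⊤
NonModal ⊥f = ⊤
NonModal (¬f φ) = NonModal φ
NonModal (φ ∧f ψ) = NonModal φ × NonModal ψ
NonModal (φ ∨f ψ) = NonModal φ × NonModal ψ
NonModal (□ φ) = ⊥

record Model : Set₁ where
  field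
    W : Set
    V : ℕ → W → Set

-- subsets of the set of worlds (information states) as predicates
record State (M : Model) : Set₁ where
  constructor st
  field
    _∋_ : Model.W M → Set
open State public

_⊆ₛ_ : {M : Model} → State M → State M → Set
X ⊆ₛ Y = ∀ v → (X ∋ v) → (Y ∋ v)

_≐ₛ_ : {M : Model} → State M → State M → Set
X ≐ₛ Y = (X ⊆ₛ Y) × (Y ⊆ₛ X)

_⊊ₛ_ : {M : Model} → State M → State M → Set
X ⊊ₛ Y = (X ⊆ₛ Y) × ¬ (Y ⊆ₛ X)

Sat : (M : Model) → Model.W M → State M → Form → Set
Sat M w X (atom p) = Model.V M p w
Sat M w X ⊥f = ⊥
Sat M w X (¬f φ) = ¬ Sat M w X φ
Sat M w X (φ ∧f ψ) = Sat M w X φ × Sat M w X ψ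
Sat M w X (φ ∨f ψ) = Sat M w X φ ⊎ Sat M w X ψ
Sat M w X (□ φ) = ∀ v → (X ∋ v) → Sat M v X φ

⟦_⟧ : {M : Model} → Form → State M → State M
⟦_⟧ {M} φ X = st (λ v → (X ∋ v) × Sat M v X φ)

⋀ : List Form → Form
⋀ = foldr _∧f_ ⊤f

⋁ : List Form → Form
⋁ = foldr _∨f_ ⊥f

elems : {n : ℕ} → Subset n → List (Fin n)
elems [] = []
elems (outside ∷ K) = map Fin.suc (elems K)
elems (inside ∷ K) = Fin.zero ∷ map Fin.suc (elems K)

allSubsets : (n : ℕ) → List (Subset n)
allSubsets ℕ.zero = [] ∷ []
allSubsets (ℕ.suc n) = map (outside ∷_) (allSubsets n) ++ map (inside ∷_) (allSubsets n)

full : (n : ℕ) → Subset n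
full ℕ.zero = []
full (ℕ.suc n) = inside ∷ full n

record ThetaData (m p : ℕ) : Set where
  field
    φ : Fin m → Form
    ψ : Fin m → Form
    χ : Fin p → Form
    D : Fin m → Subset p

module _ {m p : ℕ} (d : ThetaData m p) where
  open ThetaData d

  θ : Fin m → Form
  θ i = φ i ∧f (□ ψ i) ∧f ⋀ (map (λ n → ◇ χ n) (elems (D i)))

  Θ : Form
  Θ = ⋁ (map θ (elems (full m)))

  info : Subset m → Form
  info K = ⋁ (map φ (elems K)) ∧f ⋀ (map ψ (elems K))

  good : Subset m → Form
  good K = ⋀ (map (λ k → ⋀ (map (λ n → ◇ (info K ∧f χ n)) (elems (D k)))) (elems K))

  maxF : Subset m → Form
  maxF K = good K ∧f
    ⋀ (map (λ L → ((□ (info K →f info L)) ∧f (◇ ((¬f info K) ∧f info L))) →f ¬f good L)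
           (allSubsets m))

  AllNonModal : Set
  AllNonModal = (∀ i → NonModal (φ i)) × (∀ i → NonModal (ψ i)) × (∀ n → NonModal (χ n))

  ΘSubset : {M : Model} → State M → State M → Set
  ΘSubset {M} Y X = (Y ⊆ₛ X) × (Y ⊆ₛ ⟦ Θ ⟧ Y)

  MaximalΘSubset : {M : Model} → State M → State M → Set₁
  MaximalΘSubset {M} Y X =
    ΘSubset Y X × ((Z : State M) → ΘSubset Z X → ¬ (Y ⊊ₛ Z))

module Submission where

-- Over a fixed information state X, a Θ-subset Y of X is
-- determined by the set K_Y of indices i whose disjunct θ_i is realised
-- at some world of Y: every world of Y satisfies info_{K_Y}, and the
-- diamonds of the realised θ_i show that good_{K_Y} holds.  Conversely,
-- when good_L holds, the worlds of X satisfying info_L form a Θ-subset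
-- (each world there satisfies θ_k for a k ∈ L with φ_k true).  Both
-- directions rest on one semantic fact: nonmodal formulas do not depend
-- on the information state, so φ_k, ψ_k, χ_n and info_K may be moved
-- freely between X and its subsets.  With these two constructions,
-- maximality of a Θ-subset and the formula max_K translate into each
-- other: the clause of max_K for L is exactly the statement that the
-- strictly larger set [[info_L]] is not a Θ-subset.
--
-- Excluded middle is
-- used for subset comprehension and for the classical implication.

open import Defs
open import Level using (0ℓ)
open import Axiom.ExcludedMiddle using (ExcludedMiddle)
open import Axiom.DoubleNegationElimination using (em⇒dne)
open import Data.Nat using (ℕ)
open import Data.Fin using (Fin)
open import Data.Fin.Subset using (Subset; inside; outside)
open import Data.Vec using ([]; _∷_)
open import Data.List using (List; []; _∷_; map)
open import Data.List.Membership.Propositional using (_∈_)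
open import Data.List.Membership.Propositional.Properties
  using (∈-map⁺; ∈-map⁻; ∈-++⁺ˡ; ∈-++⁺ʳ)
open import Data.List.Relation.Unary.Any using (here; there)
open import Data.Product using (_×_; Σ; _,_; proj₁; proj₂)
open import Data.Sum using (inj₁; inj₂)
open import Data.Empty using (⊥-elim)
open import Relation.Nullary using (¬_; Dec; yes; no)
open import Relation.Binary.PropositionalEquality using (refl)

module Semantics (M : Model) where

  ⋀-intro : ∀ {A : Set} {v X} (f : A → Form) (xs : List A) →
    (∀ x → x ∈ xs → Sat M v X (f x)) → Sat M v X (⋀ (map f xs))
  ⋀-intro f []       h = λ ()
  ⋀-intro f (x ∷ xs) h = h x (here refl) , ⋀-intro f xs (λ y y∈ → h y (there y∈))

  ⋀-elim : ∀ {A : Set} {v X} (f : A → Form) (xs : List A) →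
    Sat M v X (⋀ (map f xs)) → ∀ {x} → x ∈ xs → Sat M v X (f x)
  ⋀-elim f (x ∷ xs) (s , _) (here refl) = s
  ⋀-elim f (x ∷ xs) (_ , r) (there x∈)  = ⋀-elim f xs r x∈

  ⋁-intro : ∀ {A : Set} {v X} (f : A → Form) (xs : List A) →
    ∀ {x} → x ∈ xs → Sat M v X (f x) → Sat M v X (⋁ (map f xs))
  ⋁-intro f (x ∷ xs) (here refl) s = inj₁ s
  ⋁-intro f (x ∷ xs) (there x∈)  s = inj₂ (⋁-intro f xs x∈ s)

  ⋁-elim : ∀ {A : Set} {v X} (f : A → Form) (xs : List A) →
    Sat M v X (⋁ (map f xs)) → Σ A (λ x → x ∈ xs × Sat M v X (f x))
  ⋁-elim f (x ∷ xs) (inj₁ s) = x , here refl , s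
  ⋁-elim f (x ∷ xs) (inj₂ s) with ⋁-elim f xs s
  ... | y , y∈ , t = y , there y∈ , t

  →f-elim : ∀ {v X} (φ ψ : Form) → Sat M v X (φ →f ψ) → Sat M v X φ → Sat M v X ψ
  →f-elim φ ψ (inj₁ ¬φ) s = ⊥-elim (¬φ s)
  →f-elim φ ψ (inj₂ t)  _ = t

  →f-intro : ExcludedMiddle 0ℓ → ∀ {v X} (φ ψ : Form) →
    (Sat M v X φ → Sat M v X ψ) → Sat M v X (φ →f ψ)
  →f-intro lem {v} {X} φ ψ h with lem {Sat M v X φ}
  ... | yes s = inj₂ (h s)
  ... | no ¬s = inj₁ ¬s

  nonmodal-transfer : ∀ {v} φ → NonModal φ → (X Y : State M) →
    Sat M v X φ → Sat M v Y φ
  nonmodal-transfer (atom _)  _          X Y s        = s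
  nonmodal-transfer ⊥f        _          X Y s        = s
  nonmodal-transfer (¬f φ)    n          X Y ¬s       = λ s → ¬s (nonmodal-transfer φ n Y X s)
  nonmodal-transfer (φ ∧f ψ)  (nφ , nψ)  X Y (a , b)  =
    nonmodal-transfer φ nφ X Y a , nonmodal-transfer ψ nψ X Y b
  nonmodal-transfer (φ ∨f ψ)  (nφ , _)   X Y (inj₁ a) = inj₁ (nonmodal-transfer φ nφ X Y a)
  nonmodal-transfer (φ ∨f ψ)  (_ , nψ)   X Y (inj₂ b) = inj₂ (nonmodal-transfer ψ nψ X Y b)

∈-full : ∀ {m} (i : Fin m) → i ∈ elems (full m)
∈-full Fin.zero    = here refl
∈-full (Fin.suc i) = there (∈-map⁺ Fin.suc (∈-full i))

∈-allSubsets : ∀ {n} (K : Subset n) → K ∈ allSubsets n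
∈-allSubsets []            = here refl
∈-allSubsets (outside ∷ K) = ∈-++⁺ˡ (∈-map⁺ (outside ∷_) (∈-allSubsets K))
∈-allSubsets {ℕ.suc n} (inside ∷ K) =
  ∈-++⁺ʳ (map (outside ∷_) (allSubsets n)) (∈-map⁺ (inside ∷_) (∈-allSubsets K))

Comprehends : ∀ {m} → (Fin m → Set) → Subset m → Set
Comprehends P K = (∀ i → i ∈ elems K → P i) × (∀ i → P i → i ∈ elems K)

comprehension : ∀ {m} (P : Fin m → Set) → (∀ i → Dec (P i)) →
  Σ (Subset m) (Comprehends P)
comprehension {ℕ.zero}  P dec = [] , (λ i ()) , (λ ())
comprehension {ℕ.suc m} P dec
  with comprehension (λ i → P (Fin.suc i)) (λ i → dec (Fin.suc i)) | dec Fin.zero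
... | K , sound , complete | yes P0 = inside ∷ K , sound′ , complete′
  where
  sound′ : ∀ i → i ∈ elems (inside ∷ K) → P i
  sound′ i (here refl) = P0
  sound′ i (there i∈) with ∈-map⁻ Fin.suc i∈
  ... | j , j∈ , refl = sound j j∈
  complete′ : ∀ i → P i → i ∈ elems (inside ∷ K)
  complete′ Fin.zero    _  = here refl
  complete′ (Fin.suc i) Pi = there (∈-map⁺ Fin.suc (complete i Pi))
... | K , sound , complete | no ¬P0 = outside ∷ K , sound′ , complete′
  where
  sound′ : ∀ i → i ∈ elems (outside ∷ K) → P i
  sound′ i i∈ with ∈-map⁻ Fin.suc i∈
  ... | j , j∈ , refl = sound j j∈
  complete′ : ∀ i → P i → i ∈ elems (outside ∷ K)
  complete′ Fin.zero    P0 = ⊥-elim (¬P0 P0)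
  complete′ (Fin.suc i) Pi = ∈-map⁺ Fin.suc (complete i Pi)

module Characterisation
  (lem : ExcludedMiddle 0ℓ) {m p : ℕ} (d : ThetaData m p) (nonmodal : AllNonModal d)
  (M : Model) (X : State M) where

  open Semantics M
  open ThetaData d

  nφ : ∀ i → NonModal (φ i)
  nφ = proj₁ nonmodal
  nψ : ∀ i → NonModal (ψ i)
  nψ = proj₁ (proj₂ nonmodal)
  nχ : ∀ n → NonModal (χ n)
  nχ = proj₂ (proj₂ nonmodal)

  info-elim : ∀ {v Y} K → Sat M v Y (info d K) →
    Σ (Fin m) (λ k → k ∈ elems K × Sat M v Y (φ k))
    × (∀ k → k ∈ elems K → Sat M v Y (ψ k))
  info-elim K (someφ , allψ) = ⋁-elim φ (elems K) someφ , λ k k∈ → ⋀-elim ψ (elems K) allψ k∈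

  info-intro : ∀ {v Y} K {k} → k ∈ elems K → Sat M v Y (φ k) →
    (∀ k → k ∈ elems K → Sat M v Y (ψ k)) → Sat M v Y (info d K)
  info-intro K k∈ s allψ = ⋁-intro φ (elems K) k∈ s , ⋀-intro ψ (elems K) allψ

  Good : Model.W M → State M → Subset m → Set
  Good v Y K = Sat M v Y (good d K)

  good-elim : ∀ {v Y} K → Good v Y K → ∀ {k} → k ∈ elems K → ∀ {n} → n ∈ elems (D k) →
    Sat M v Y (◇ (info d K ∧f χ n))
  good-elim K g {k} k∈ n∈ =
    ⋀-elim (λ n → ◇ (info d K ∧f χ n)) (elems (D k))
      (⋀-elim (λ k → ⋀ (map (λ n → ◇ (info d K ∧f χ n)) (elems (D k)))) (elems K) g k∈) n∈

  good-intro : ∀ {v Y} K →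
    (∀ k → k ∈ elems K → ∀ n → n ∈ elems (D k) → Sat M v Y (◇ (info d K ∧f χ n))) →
    Good v Y K
  good-intro K h = ⋀-intro (λ k → ⋀ (map (λ n → ◇ (info d K ∧f χ n)) (elems (D k)))) (elems K)
    (λ k k∈ → ⋀-intro (λ n → ◇ (info d K ∧f χ n)) (elems (D k)) (h k k∈))

  extension : Subset m → Subset m → Form
  extension L K = (□ (info d L →f info d K)) ∧f (◇ ((¬f info d L) ∧f info d K))

  max-elim : ∀ {v} L → Sat M v X (maxF d L) → ∀ K → Sat M v X (extension L K) → ¬ Good v X K
  max-elim L (_ , clauses) K ext =
    →f-elim (extension L K) (¬f good d K) (⋀-elim (λ K → extension L K →f ¬f good d K) (allSubsets m)
      clauses (∈-allSubsets K)) ext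

  max-intro : ∀ {v} L → Good v X L → (∀ K → Sat M v X (extension L K) → ¬ Good v X K) →
    Sat M v X (maxF d L)
  max-intro L g h = g , ⋀-intro (λ K → extension L K →f ¬f good d K) (allSubsets m)
    λ K _ → →f-intro lem (extension L K) (¬f good d K) (h K)

  Θ-intro : ∀ {v Y} k → Sat M v Y (θ d k) → Sat M v Y (Θ d)
  Θ-intro k = ⋁-intro (θ d) (elems (full m)) (∈-full k)

  Θ-elim : ∀ {v Y} → Sat M v Y (Θ d) → Σ (Fin m) (λ k → Sat M v Y (θ d k))
  Θ-elim s with ⋁-elim (θ d) (elems (full m)) s
  ... | k , _ , t = k , t

  -- A world
  -- of [[info_L]] with φ_k true (k ∈ L) satisfies θ_k there: □ψ_k because
  -- all of [[info_L]] satisfies ψ_k, and each ◇χ_n by good_L.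
  good⇒ΘSubset : ∀ {w} L → Good w X L → ΘSubset d (⟦ info d L ⟧ X) X
  good⇒ΘSubset L g = (λ v → proj₁) , λ v v∈ → v∈ , realises v v∈
    where
    Y = ⟦ info d L ⟧ X
    realises : ∀ v → Y ∋ v → Sat M v Y (Θ d)
    realises v (_ , infoL) with info-elim L infoL
    ... | (k , k∈ , φk) , _ =
      Θ-intro k
        ( nonmodal-transfer (φ k) (nφ k) X Y φk
        , (λ u (_ , infoL′) → nonmodal-transfer (ψ k) (nψ k) X Y (proj₂ (info-elim L infoL′) k k∈))
        , ⋀-intro (λ n → ◇ χ n) (elems (D k)) (λ n n∈ noχ →
            good-elim L g k∈ n∈ λ u u∈X (infoL′ , χn) →
              noχ u (u∈X , infoL′) (nonmodal-transfer (χ n) (nχ n) X Y χn)))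

  module IndexSet (Z : State M) (ZΘ : ΘSubset d Z X) where

    Realised : Fin m → Set
    Realised i = Σ (Model.W M) (λ v → (Z ∋ v) × Sat M v Z (θ d i))

    K : Subset m
    K = proj₁ (comprehension Realised (λ _ → lem))

    realised : ∀ i → i ∈ elems K → Realised i
    realised = proj₁ (proj₂ (comprehension Realised (λ _ → lem)))

    index∈K : ∀ i → Realised i → i ∈ elems K
    index∈K = proj₂ (proj₂ (comprehension Realised (λ _ → lem)))

    -- Every world of Z satisfies info_{K_Z}: its own θ_k gives φ_k, and the
    -- □ψ_i of every realised θ_i gives ψ_i.
    ⊆info : Z ⊆ₛ ⟦ info d K ⟧ X
    ⊆info v v∈ with Θ-elim (proj₂ (proj₂ ZΘ v v∈))
    ... | k , θk = proj₁ ZΘ v v∈ ,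
      info-intro K (index∈K k (v , v∈ , θk)) (nonmodal-transfer (φ k) (nφ k) Z X (proj₁ θk))
        (λ i i∈ → let (_ , _ , θi) = realised i i∈ in
           nonmodal-transfer (ψ i) (nψ i) Z X (proj₁ (proj₂ θi) v v∈))

    -- good_{K_Z} holds: the witness of ◇χ_n in a realised θ_k lies in Z,
    -- hence satisfies info_{K_Z}.
    isGood : ∀ {v} → Good v X K
    isGood = good-intro K λ k k∈ n n∈ none →
      let (_ , _ , θk) = realised k k∈ in
      ⋀-elim (λ n → ◇ χ n) (elems (D k)) (proj₂ (proj₂ θk)) n∈ λ t t∈ χn →
        none t (proj₁ ZΘ t t∈) (proj₂ (⊆info t t∈) , nonmodal-transfer (χ n) (nχ n) Z X χn)

  -- Part (2): a maximal Θ-subset Y equals [[info_K]] for K = K_Y, and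
  -- max_K holds: a good L whose info strictly extends info_K would give the
  -- Θ-subset [[info_L]] strictly above Y.
  maximal⇒max : ∀ w Y → MaximalΘSubset d Y X →
    Σ (Subset m) (λ K → (Y ≐ₛ ⟦ info d K ⟧ X) × Sat M w X (maxF d K))
  maximal⇒max w Y (YΘ , maximal) =
    K , (⊆info , info⊆) , max-intro K isGood no-good-extension
    where
    open IndexSet Y YΘ
    info⊆ : ⟦ info d K ⟧ X ⊆ₛ Y
    info⊆ = em⇒dne lem λ ¬⊆ → maximal _ (good⇒ΘSubset K (isGood {w})) (⊆info , ¬⊆)
    no-good-extension : ∀ L → Sat M w X (extension K L) → ¬ Good w X L
    no-good-extension L (box , dia) g = maximal _ (good⇒ΘSubset L g)
      ( (λ v v∈ → let (v∈X , infoK) = ⊆info v v∈ in v∈X , →f-elim (info d K) (info d L) (box v v∈X) infoK)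
      , λ ⊆Y → dia λ u u∈X (¬infoK , infoL) → ¬infoK (proj₂ (⊆info u (⊆Y u (u∈X , infoL)))))

  -- Part (3): if max_L holds, [[info_L]] is maximal: a Θ-subset Z strictly
  -- above it would make K_Z a good strict extension of L.
  max⇒maximal : ∀ w L → Sat M w X (maxF d L) → MaximalΘSubset d (⟦ info d L ⟧ X) X
  max⇒maximal w L maxL = good⇒ΘSubset L (proj₁ maxL) , no-larger
    where
    no-larger : (Z : State M) → ΘSubset d Z X → ¬ (⟦ info d L ⟧ X ⊊ₛ Z)
    no-larger Z ZΘ (⊆Z , ¬Z⊆) = max-elim L maxL K (box , dia) isGood
      where
      open IndexSet Z ZΘ
      box : Sat M w X (□ (info d L →f info d K))
      box u u∈X = →f-intro lem (info d L) (info d K) λ infoL → proj₂ (⊆info u (⊆Z u (u∈X , infoL)))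
      dia : Sat M w X (◇ ((¬f info d L) ∧f info d K))
      dia none = ¬Z⊆ λ u u∈Z → proj₁ ZΘ u u∈Z ,
        em⇒dne lem λ ¬infoL → none u (proj₁ ZΘ u u∈Z) (¬infoL , proj₂ (⊆info u u∈Z))

lemma6 : ExcludedMiddle 0ℓ → {m p : ℕ} (d : ThetaData m p) → AllNonModal d →
    (M : Model) (w : Model.W M) (X : State M) →
    ((L : Subset m) → Sat M w X (good d L) → ΘSubset d (⟦ info d L ⟧ X) X)
    × ((Y : State M) → MaximalΘSubset d Y X →
    Σ (Subset m) (λ K → (Y ≐ₛ ⟦ info d K ⟧ X) × Sat M w X (maxF d K)))
    × ((L : Subset m) → Sat M w X (maxF d L) → MaximalΘSubset d (⟦ info d L ⟧ X) X)
lemma6 lem d nonmodal M w X = good⇒ΘSubset , maximal⇒max w , max⇒maximal w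
  where open Characterisation lem d nonmodal M X
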